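{- $22 \leq R(B_4, B_7) \leq 23$.
   Context: For graphs $G,H$, the Ramsey number $R(G,H)$ is the smallest $n$ such that every red-blue edge-coloring of $K_n$ contains a red copy of $G$ or a blue copy of $H$ (copies as subgraphs, not necessarily induced). The book $B_k$ is the graph on $k+2$ vertices consisting of an edge $uv$ together with $k$ further vertices, each adjacent exactly to $u$ and $v$. -}

module Defs where

open import Data.Nat using (ℕ; suc)
open import Data.Fin using (Fin; zero; suc)
open import Data.Unit using (⊤)
open import Data.Empty using (⊥)
open import Data.Sum using (_⊎_)
open import Data.Product using (Σ; _×_)
open import Relation.Binary.PropositionalEquality using (_≡_)
open import Function.Definitions using (Injective)

Graph : ℕ → Set₁
Graph m = Fin m → Fin m → Set

-- The book B_k on k+2 vertices: vertex 0 = u, vertex 1 = v, vertices 2..k+1 the pages;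
-- edge uv, and each page adjacent exactly to u and v.
BookAdj : (k : ℕ) → Graph (suc (suc k))
BookAdj k zero          (suc zero)    = ⊤
BookAdj k (suc zero)    zero          = ⊤
BookAdj k zero          (suc (suc _)) = ⊤
BookAdj k (suc (suc _)) zero          = ⊤
BookAdj k (suc zero)    (suc (suc _)) = ⊤
BookAdj k (suc (suc _)) (suc zero)    = ⊤
BookAdj k _             _             = ⊥

data Colour : Set where
  red blue : Colour

-- A red-blue edge-colouring of K_n: a symmetric colour function on pairs
-- (values on the diagonal are irrelevant).
record Colouring (n : ℕ) : Set where
  field
    col : Fin n → Fin n → Colour
    sym : ∀ i j → col i j ≡ col j i
open Colouring public

-- A (not necessarily induced) copy of G in colour χ: an injective vertex map
-- sending every edge of G to an edge of colour χ.
HasCopy : {m n : ℕ} → Colour → Colouring n → Graph m → Set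
HasCopy {m} {n} χ c G =
  Σ (Fin m → Fin n) λ f →
    Injective _≡_ _≡_ f × (∀ i j → G i j → col c (f i) (f j) ≡ χ)

-- R(G,H) is the least such n; so R(G,H) ≤ n iff Arrows n G H, and
-- R(G,H) > n iff ¬ Arrows n G H (arrowing is monotone in n).
Arrows : {m m' : ℕ} → ℕ → Graph m → Graph m' → Set
Arrows n G H = (c : Colouring n) → HasCopy red c G ⊎ HasCopy blue c H

{-# OPTIONS --safe #-}

-- A red B₄ or a blue B₇ is exactly an edge with 4 common red, resp. 7 common blue, neighbours.
--
-- Lower bound: a colouring of K₂₁ with three blocks of seven vertices, invariant under ℤ₇, in which
-- every red edge has at most 3 common red and every blue edge at most 6 common blue neighbours.
--
-- Upper bound: in such a colouring of K₂₃, summing degrees over edges gives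
-- Σₓ (r² + b²) ≤ Σₓ (rb + 4r + 7b) for the red and blue degrees r, b of x, while r + b = 22 makes
-- each term of the difference 3(r − 10)(r − 11) ≥ 0. So everything is tight: all red degrees are
-- 10 or 11 and the codegree bounds are attained on every edge. Counting edges in a red
-- neighbourhood, 3r is even, so r = 10, b = 12, and the blue adjacency matrix satisfies
-- B² = 6I + 6J. Then tr B⁷ = 23 · 1557792 ≢ 0 (mod 7), whereas tr A⁷ ≡ 0 (mod 7) for every
-- matrix A with zero diagonal, since rotation permutes the closed walks of length 7 of nonzero
-- weight in orbits of size 7.

module Submission where

open import Defs renaming (sym to col-sym)

open import Data.Bool using (if_then_else_)
open import Data.Bool.ListAction using (any)
open import Data.Empty using (⊥; ⊥-elim)
open import Data.Fin using (Fin; zero; suc; toℕ; punchIn; punchOut; _≟_)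
open import Data.Fin.Properties
  using (punchInᵢ≢i; punchIn-injective; punchOut-injective; punchIn-punchOut; suc-injective; toℕ-injective;
         toℕ-fromℕ<; toℕ<n; any?; all?; ≤-decTotalOrder)
open import Data.List using (List; []; _∷_; allFin)
open import Data.List.Membership.Propositional.Properties using (∈-allFin)
import Data.List.Relation.Unary.All as All
open import Data.Nat using (ℕ; zero; suc; _+_; _*_; _∸_; _/_; _%_; _≡ᵇ_; _≤_; _<_; z≤n; s≤s; _≤?_)
open import Data.Nat.DivMod using (m≡m%n+[m/n]*n; _mod_; m%n<n)
open import Data.Nat.Divisibility using (_∣_; _∣?_; _∣0; ∣m∣n⇒∣m+n; m∣m*n)
open import Data.Nat.GeneralisedArithmetic using (fold; fold-+)
open import Data.Nat.Properties
  using (+-*-semiring; +-identityʳ; +-assoc; *-identityˡ; *-identityʳ; *-zeroʳ; *-comm; *-assoc; *-distribˡ-+;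
         +-cancelˡ-≡; +-cancelʳ-≡; +-cancelˡ-≤; +-cancelʳ-≤; +-mono-≤; +-monoˡ-≤; +-monoʳ-≤; +-monoʳ-<;
         ≤-refl; ≤-reflexive; ≤-trans; ≤-antisym; <⇒≤; ≮⇒≥; <⇒≱; <-cmp;
         m≤m+n; m≤n+m; m∸n+n≡m; m+n∸m≡n; m<n⇒0<n∸m; allUpTo?)
  renaming (_≟_ to _≟ℕ_)
open import Data.Nat.Tactic.RingSolver using (solve-∀)
open import Data.Product using (Σ; ∃; ∃₂; _×_; _,_; proj₁; proj₂)
open import Data.Sum using (_⊎_; inj₁; inj₂; [_,_]′)
open import Data.Unit using (tt)
open import Data.Vec using (Vec; []; _∷_; _∷ʳ_)
open import Data.Vec.Functional using () renaming (_∷_ to _∷ᶠ_)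
open import Data.Vec.Properties using (≡-dec; ∷-injectiveˡ)
import Data.Vec.Relation.Binary.Lex.NonStrict as Lex
open import Data.Vec.Relation.Binary.Pointwise.Inductive using (Pointwise-≡⇒≡)
open import Function using (id)
open import Function.Definitions using (Injective)
open import Relation.Binary.Bundles using (DecTotalOrder)
open import Relation.Binary.Definitions using (tri<; tri≈; tri>)
open import Relation.Binary.PropositionalEquality
  using (_≡_; _≢_; refl; sym; trans; cong; cong₂; subst; subst₂; module ≡-Reasoning)
open import Relation.Nullary using (¬_; Dec; yes; no)
open import Relation.Nullary.Decidable using (_×-dec_; _→-dec_; _⊎-dec_; ¬?; from-yes; from-no)
open import Relation.Unary using (Pred; Decidable)

open import Algebra.Properties.Semiring.Sum +-*-semiring
  using (sum; sum-syntax; ∑-distrib-+; ∑-comm; *-distribˡ-sum; *-distribʳ-sum;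
         sum-cong-≗; sum-remove; sum-replicate-zero)

∑-const : ∀ n c → ∑[ i < n ] c ≡ n * c
∑-const zero    c = refl
∑-const (suc n) c = cong (c +_) (∑-const n c)

∑-distrib-+₃ : ∀ {n} (f g h : Fin n → ℕ) → ∑[ i < n ] (f i + g i + h i) ≡ sum f + sum g + sum h
∑-distrib-+₃ f g h = trans (∑-distrib-+ (λ i → f i + g i) h) (cong (_+ sum h) (∑-distrib-+ f g))

∑-mono-≤ : ∀ {n} {f g : Fin n → ℕ} → (∀ i → f i ≤ g i) → sum f ≤ sum g
∑-mono-≤ {zero}  f≤g = z≤n
∑-mono-≤ {suc n} f≤g = +-mono-≤ (f≤g zero) (∑-mono-≤ λ i → f≤g (suc i))

∑-squeeze : ∀ {n} {f g : Fin n → ℕ} → (∀ i → f i ≤ g i) → sum g ≤ sum f → ∀ i → f i ≡ g i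
∑-squeeze {suc n} {f} {g} f≤g ∑g≤∑f zero = ≤-antisym (f≤g zero)
  (+-cancelʳ-≤ (sum (λ i → g (suc i))) (g zero) (f zero)
    (≤-trans ∑g≤∑f (+-monoʳ-≤ (f zero) (∑-mono-≤ (λ i → f≤g (suc i))))))
∑-squeeze {suc n} {f} {g} f≤g ∑g≤∑f (suc i) = ∑-squeeze (λ i → f≤g (suc i))
  (+-cancelˡ-≤ (g zero) _ _ (≤-trans ∑g≤∑f (+-monoˡ-≤ _ (f≤g zero)))) i

∑∑-squeeze : ∀ {m n} {f g : Fin m → Fin n → ℕ} → (∀ i j → f i j ≤ g i j) →
             ∑[ i < m ] ∑[ j < n ] g i j ≤ ∑[ i < m ] ∑[ j < n ] f i j → ∀ i j → f i j ≡ g i j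
∑∑-squeeze f≤g ∑∑g≤∑∑f i =
  ∑-squeeze (f≤g i) (≤-reflexive (sym (∑-squeeze (λ i → ∑-mono-≤ (f≤g i)) ∑∑g≤∑∑f i)))

𝟙 : ∀ {p} {P : Set p} → Dec P → ℕ
𝟙 (yes _) = 1
𝟙 (no _)  = 0

module _ {p} {P : Set p} where

  𝟙-yes : (P? : Dec P) → P → 𝟙 P? ≡ 1
  𝟙-yes (yes _) _  = refl
  𝟙-yes (no ¬p) p = ⊥-elim (¬p p)

  𝟙-no : (P? : Dec P) → ¬ P → 𝟙 P? ≡ 0
  𝟙-no (yes p) ¬p = ⊥-elim (¬p p)
  𝟙-no (no _)  _  = refl

  𝟙-*-cong : ∀ (P? : Dec P) {a b} → (P → a ≡ b) → 𝟙 P? * a ≡ 𝟙 P? * b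
  𝟙-*-cong (yes p) a≡b = cong (_+ 0) (a≡b p)
  𝟙-*-cong (no _)  _   = refl

  𝟙-cong : ∀ {q} {Q : Set q} (P? : Dec P) (Q? : Dec Q) → (P → Q) → (Q → P) → 𝟙 P? ≡ 𝟙 Q?
  𝟙-cong (yes _) (yes _) _   _   = refl
  𝟙-cong (no _)  (no _)  _   _   = refl
  𝟙-cong (yes p) (no ¬q) p→q _   = ⊥-elim (¬q (p→q p))
  𝟙-cong (no ¬p) (yes q) _   q→p = ⊥-elim (¬p (q→p q))

  𝟙-× : ∀ {q} {Q : Set q} (P? : Dec P) (Q? : Dec Q) → 𝟙 (P? ×-dec Q?) ≡ 𝟙 P? * 𝟙 Q?
  𝟙-× (yes _) (yes _) = refl
  𝟙-× (yes _) (no _)  = refl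
  𝟙-× (no _)  _       = refl

δ : ∀ {n} → Fin n → Fin n → ℕ
δ i j = 𝟙 (i ≟ j)

δ-sym : ∀ {n} (i j : Fin n) → δ i j ≡ δ j i
δ-sym i j = 𝟙-cong (i ≟ j) (j ≟ i) sym sym

δ-refl : ∀ {n} (i : Fin n) → δ i i ≡ 1
δ-refl i = 𝟙-yes (i ≟ i) refl

∑-δ : ∀ {n} (f : Fin n → ℕ) (j : Fin n) → ∑[ i < n ] (f i * δ i j) ≡ f j
∑-δ {suc n} f j = begin
  sum (λ i → f i * δ i j)                                        ≡⟨ sum-remove {i = j} (λ i → f i * δ i j) ⟩
  f j * δ j j + sum (λ k → f (punchIn j k) * δ (punchIn j k) j)  ≡⟨ cong₂ _+_ (cong (f j *_) (δ-refl j))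
                                                                               (sum-cong-≗ off-diagonal) ⟩
  f j * 1 + sum {n} (λ _ → 0)                                    ≡⟨ cong₂ _+_ (*-identityʳ (f j))
                                                                               (sum-replicate-zero n) ⟩
  f j + 0                                                        ≡⟨ +-identityʳ (f j) ⟩
  f j                                                            ∎
  where
  open ≡-Reasoning
  off-diagonal : ∀ k → f (punchIn j k) * δ (punchIn j k) j ≡ 0
  off-diagonal k = trans (cong (f (punchIn j k) *_) (𝟙-no (punchIn j k ≟ j) (punchInᵢ≢i j k)))
                         (*-zeroʳ (f (punchIn j k)))

count : ∀ {n p} {P : Pred (Fin n) p} → Decidable P → ℕ
count {n} P? = ∑[ i < n ] 𝟙 (P? i)

module _ {n k : ℕ} where

  pred-injection : (g : Fin k → Fin (suc n)) → Injective _≡_ _≡_ g → (∀ i → g i ≢ zero) →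
                   Σ (Fin k → Fin n) λ h → Injective _≡_ _≡_ h × (∀ i → suc (h i) ≡ g i)
  pred-injection g g-inj g≢0 =
    h , (λ e → g-inj (punchOut-injective (0≢g _) (0≢g _) e)) , λ i → punchIn-punchOut (0≢g i)
    where
    0≢g : ∀ i → zero ≢ g i
    0≢g i 0≡g = g≢0 i (sym 0≡g)
    h : Fin k → Fin n
    h i = punchOut (0≢g i)

  zero∷suc-injective : (g : Fin k → Fin n) → Injective _≡_ _≡_ g →
                       Injective {A = Fin (suc k)} {B = Fin (suc n)} _≡_ _≡_ (zero ∷ᶠ λ i → suc (g i))
  zero∷suc-injective g g-inj {zero}  {zero}  _ = refl
  zero∷suc-injective g g-inj {suc i} {suc j} e = cong suc (g-inj (suc-injective e))

injection⇒≤count : ∀ {n k p} {P : Pred (Fin n) p} (P? : Decidable P) (g : Fin k → Fin n) →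
                   Injective _≡_ _≡_ g → (∀ i → P (g i)) → k ≤ count P?
injection⇒≤count {zero} {zero}  _ _ _ _ = z≤n
injection⇒≤count {zero} {suc k} _ g _ _ with g zero
... | ()
injection⇒≤count {suc n} {P = P} P? g g-inj Pg with any? (λ i → g i ≟ zero)
... | no ∄i with pred-injection g g-inj (λ i gi≡0 → ∄i (i , gi≡0))
...   | h , h-inj , sh≡g =
  ≤-trans (injection⇒≤count (λ i → P? (suc i)) h h-inj (λ i → subst P (sym (sh≡g i)) (Pg i))) (m≤n+m _ _)
injection⇒≤count {suc n} {suc k} {P = P} P? g g-inj Pg | yes (i₀ , gi₀≡0)
  with pred-injection (λ j → g (punchIn i₀ j)) (λ e → punchIn-injective i₀ _ _ (g-inj e))
                      (λ j gj≡0 → punchInᵢ≢i i₀ j (g-inj (trans gj≡0 (sym gi₀≡0))))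
... | h , h-inj , sh≡g =
  +-mono-≤ (subst (1 ≤_) (sym (𝟙-yes (P? zero) (subst P gi₀≡0 (Pg i₀)))) ≤-refl)
           (injection⇒≤count (λ i → P? (suc i)) h h-inj (λ j → subst P (sym (sh≡g j)) (Pg (punchIn i₀ j))))

≤count⇒injection : ∀ {n p} {P : Pred (Fin n) p} (P? : Decidable P) k → k ≤ count P? →
                   Σ (Fin k → Fin n) λ g → Injective _≡_ _≡_ g × (∀ i → P (g i))
≤count⇒injection {zero} P? zero _ = (λ ()) , (λ { {()} }) , (λ ())
≤count⇒injection {suc n} P? k k≤ with P? zero
... | no _ with ≤count⇒injection (λ i → P? (suc i)) k k≤
...   | g , g-inj , Pg = (λ i → suc (g i)) , (λ e → g-inj (suc-injective e)) , Pg
≤count⇒injection {suc n} P? zero k≤ | yes _ = (λ ()) , (λ { {()} }) , (λ ())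
≤count⇒injection {suc n} P? (suc k) (s≤s k≤) | yes P0 with ≤count⇒injection (λ i → P? (suc i)) k k≤
... | g , g-inj , Pg =
  (zero ∷ᶠ λ i → suc (g i)) , zero∷suc-injective g g-inj , λ { zero → P0 ; (suc i) → Pg i }

handshake : ∀ {n} (Q : Fin n → Fin n → ℕ) → (∀ i j → Q i j ≡ Q j i) → (∀ i → Q i i ≡ 0) →
            2 ∣ ∑[ i < n ] ∑[ j < n ] Q i j
handshake {zero}  Q Q-sym Q-diag = 2 ∣0
handshake {suc n} Q Q-sym Q-diag = subst (2 ∣_) (sym split) (∣m∣n⇒∣m+n (m∣m*n first) rest-even)
  where
  open ≡-Reasoning
  first rest : ℕ
  first = ∑[ j < n ] Q zero (suc j)
  rest  = ∑[ i < n ] ∑[ j < n ] Q (suc i) (suc j)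
  rest-even : 2 ∣ rest
  rest-even = handshake (λ i j → Q (suc i) (suc j)) (λ i j → Q-sym (suc i) (suc j)) (λ i → Q-diag (suc i))
  split : ∑[ i < suc n ] ∑[ j < suc n ] Q i j ≡ 2 * first + rest
  split = begin
    Q zero zero + first + ∑[ i < n ] (Q (suc i) zero + ∑[ j < n ] Q (suc i) (suc j))
      ≡⟨ cong₂ (λ q r → q + first + r) (Q-diag zero) (∑-distrib-+ (λ i → Q (suc i) zero) _) ⟩
    first + (∑[ i < n ] Q (suc i) zero + rest)
      ≡⟨ cong (λ q → first + (q + rest)) (sum-cong-≗ (λ i → Q-sym (suc i) zero)) ⟩
    first + (first + rest)
      ≡⟨ sym (+-assoc first first rest) ⟩
    first + first + rest
      ≡⟨ cong (λ q → first + q + rest) (sym (+-identityʳ first)) ⟩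
    2 * first + rest ∎

_≟ᶜ_ : (χ ψ : Colour) → Dec (χ ≡ ψ)
red  ≟ᶜ red  = yes refl
blue ≟ᶜ blue = yes refl
red  ≟ᶜ blue = no λ ()
blue ≟ᶜ red  = no λ ()

other : Colour → Colour
other red  = blue
other blue = red

other-≢ : ∀ χ → χ ≢ other χ
other-≢ red  ()
other-≢ blue ()

colour-cases : ∀ χ ψ → ψ ≡ χ ⊎ ψ ≡ other χ
colour-cases red  red  = inj₁ refl
colour-cases red  blue = inj₂ refl
colour-cases blue red  = inj₂ refl
colour-cases blue blue = inj₁ refl

module ColourGraph {n} (c : Colouring n) where

  Adj : Colour → Fin n → Fin n → Set
  Adj χ x y = x ≢ y × col c x y ≡ χ

  adj? : ∀ χ x y → Dec (Adj χ x y)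
  adj? χ x y = ¬? (x ≟ y) ×-dec (col c x y ≟ᶜ χ)

  A : Colour → Fin n → Fin n → ℕ
  A χ x y = 𝟙 (adj? χ x y)

  deg : Colour → Fin n → ℕ
  deg χ x = ∑[ y < n ] A χ x y

  paths : Colour → Colour → Fin n → Fin n → ℕ
  paths χ ψ x y = ∑[ v < n ] (A χ x v * A ψ v y)

  codeg : Colour → Fin n → Fin n → ℕ
  codeg χ = paths χ χ

  module _ {χ : Colour} where

    Adj-sym : ∀ {x y} → Adj χ x y → Adj χ y x
    Adj-sym (x≢y , xy∈χ) = (λ y≡x → x≢y (sym y≡x)) , trans (col-sym c _ _) xy∈χ

    A-sym : ∀ x y → A χ x y ≡ A χ y x
    A-sym x y = 𝟙-cong (adj? χ x y) (adj? χ y x) Adj-sym Adj-sym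

    A-irrefl : ∀ x → A χ x x ≡ 0
    A-irrefl x = 𝟙-no (adj? χ x x) λ (x≢x , _) → x≢x refl

    A-other : ∀ {x y} → Adj χ x y → A (other χ) x y ≡ 0
    A-other (_ , xy∈χ) = 𝟙-no (adj? _ _ _) λ (_ , xy∈χ′) → other-≢ χ (trans (sym xy∈χ) xy∈χ′)

  edge-cases : ∀ x y → x ≡ y ⊎ Adj red x y ⊎ Adj blue x y
  edge-cases x y with x ≟ y | colour-cases red (col c x y)
  ... | yes x≡y | _            = inj₁ x≡y
  ... | no x≢y  | inj₁ xy∈red  = inj₂ (inj₁ (x≢y , xy∈red))
  ... | no x≢y  | inj₂ xy∈blue = inj₂ (inj₂ (x≢y , xy∈blue))

  A-partition : ∀ χ x y → A χ x y + A (other χ) x y + δ x y ≡ 1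
  A-partition χ x y with x ≟ y | col c x y
  A-partition _    x y | yes refl | _    = refl
  A-partition red  x y | no _     | red  = refl
  A-partition red  x y | no _     | blue = refl
  A-partition blue x y | no _     | red  = refl
  A-partition blue x y | no _     | blue = refl

  paths-reverse : ∀ χ ψ x y → paths χ ψ x y ≡ paths ψ χ y x
  paths-reverse χ ψ x y = sum-cong-≗ λ v →
    trans (cong₂ _*_ (A-sym x v) (A-sym v y)) (*-comm (A χ v x) (A ψ y v))

  codeg-diag : ∀ χ x → codeg χ x x ≡ deg χ x
  codeg-diag χ x = sum-cong-≗ λ v →
    trans (𝟙-*-cong (adj? χ x v) (λ xv∈χ → 𝟙-yes (adj? χ v x) (Adj-sym xv∈χ))) (*-identityʳ (A χ x v))

  codeg≡count : ∀ χ x y → codeg χ x y ≡ count (λ v → adj? χ x v ×-dec adj? χ v y)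
  codeg≡count χ x y = sum-cong-≗ λ v → sym (𝟙-× (adj? χ x v) (adj? χ v y))

  ∑-column : ∀ χ y → ∑[ x < n ] A χ x y ≡ deg χ y
  ∑-column χ y = sum-cong-≗ λ x → A-sym x y

  deg-split : ∀ χ x y → codeg χ x y + paths χ (other χ) x y + A χ x y ≡ deg χ x
  deg-split χ x y = begin
    codeg χ x y + paths χ (other χ) x y + A χ x y
      ≡⟨ cong (codeg χ x y + paths χ (other χ) x y +_) (sym (∑-δ (A χ x) y)) ⟩
    codeg χ x y + paths χ (other χ) x y + ∑[ v < n ] (A χ x v * δ v y)
      ≡⟨ sym (∑-distrib-+₃ (λ v → A χ x v * A χ v y) (λ v → A χ x v * A (other χ) v y)
                           (λ v → A χ x v * δ v y)) ⟩
    ∑[ v < n ] (A χ x v * A χ v y + A χ x v * A (other χ) v y + A χ x v * δ v y)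
      ≡⟨ sum-cong-≗ (λ v → sym (distrib₃ (A χ x v) _ _ _)) ⟩
    ∑[ v < n ] (A χ x v * (A χ v y + A (other χ) v y + δ v y))
      ≡⟨ sum-cong-≗ (λ v → trans (cong (A χ x v *_) (A-partition χ v y)) (*-identityʳ (A χ x v))) ⟩
    deg χ x ∎
    where
    open ≡-Reasoning
    distrib₃ : ∀ a p q r → a * (p + q + r) ≡ a * p + a * q + a * r
    distrib₃ a p q r = trans (*-distribˡ-+ a (p + q) r) (cong (_+ a * r) (*-distribˡ-+ a p q))

  deg-split′ : ∀ χ x y → codeg χ x y + paths (other χ) χ x y + A χ x y ≡ deg χ y
  deg-split′ χ x y = trans
    (cong₂ _+_ (cong₂ _+_ (paths-reverse χ χ x y) (paths-reverse (other χ) χ x y)) (A-sym x y))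
    (deg-split χ y x)

  deg-sum : ∀ χ x → deg χ x + deg (other χ) x + 1 ≡ n
  deg-sum χ x = begin
    deg χ x + deg (other χ) x + 1                      ≡⟨ cong (deg χ x + deg (other χ) x +_) ones ⟩
    deg χ x + deg (other χ) x + ∑[ v < n ] δ x v       ≡⟨ sym (∑-distrib-+₃ (A χ x) (A (other χ) x) (δ x)) ⟩
    ∑[ v < n ] (A χ x v + A (other χ) x v + δ x v)     ≡⟨ sum-cong-≗ (A-partition χ x) ⟩
    ∑[ v < n ] 1                                       ≡⟨ ∑-const n 1 ⟩
    n * 1                                              ≡⟨ *-identityʳ n ⟩
    n                                                  ∎
    where
    open ≡-Reasoning
    ones : 1 ≡ ∑[ v < n ] δ x v
    ones = trans (sym (∑-δ (λ _ → 1) x)) (sum-cong-≗ λ v → trans (*-identityˡ _) (δ-sym v x))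

  codeg≡k⇒2∣k*deg : ∀ χ k → (∀ x y → Adj χ x y → codeg χ x y ≡ k) → ∀ x → 2 ∣ k * deg χ x
  codeg≡k⇒2∣k*deg χ k codeg≡k x = subst (2 ∣_) (sym triangles) (handshake Q Q-sym Q-diag)
    where
    open ≡-Reasoning
    Q : Fin n → Fin n → ℕ
    Q w v = A χ x w * (A χ x v * A χ v w)
    Q-sym : ∀ w v → Q w v ≡ Q v w
    Q-sym w v = trans (cong (λ a → A χ x w * (A χ x v * a)) (A-sym v w))
                      (swap (A χ x w) (A χ x v) (A χ w v))
      where
      swap : ∀ a b e → a * (b * e) ≡ b * (a * e)
      swap = solve-∀
    Q-diag : ∀ w → Q w w ≡ 0
    Q-diag w = trans (cong (λ a → A χ x w * (A χ x w * a)) (A-irrefl w))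
                     (trans (cong (A χ x w *_) (*-zeroʳ (A χ x w))) (*-zeroʳ (A χ x w)))
    triangles : k * deg χ x ≡ ∑[ w < n ] ∑[ v < n ] Q w v
    triangles = begin
      k * deg χ x                          ≡⟨ *-distribˡ-sum k (A χ x) ⟩
      ∑[ w < n ] (k * A χ x w)             ≡⟨ sum-cong-≗ (λ w → trans (*-comm k (A χ x w))
                                                 (𝟙-*-cong (adj? χ x w) λ xw → sym (codeg≡k x w xw))) ⟩
      ∑[ w < n ] (A χ x w * codeg χ x w)   ≡⟨ sum-cong-≗ (λ w → *-distribˡ-sum (A χ x w)
                                                                               (λ v → A χ x v * A χ v w)) ⟩
      ∑[ w < n ] ∑[ v < n ] Q w v          ∎

  CodegreeBound : Colour → ℕ → Set
  CodegreeBound χ s = ∀ x y → Adj χ x y → codeg χ x y ≤ s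

  codegreeBound? : ∀ χ s → Dec (CodegreeBound χ s)
  codegreeBound? χ s = all? λ x → all? λ y → adj? χ x y →-dec (codeg χ x y ≤? s)

  module _ {χ : Colour} {k : ℕ} where

    book⇒codeg≥ : HasCopy χ c (BookAdj k) → ∃₂ λ x y → Adj χ x y × k ≤ codeg χ x y
    book⇒codeg≥ (f , f-inj , f-col) = f zero , f (suc zero) , edge zero (suc zero) (λ ()) tt , k≤codeg
      where
      edge : ∀ i j → i ≢ j → BookAdj k i j → Adj χ (f i) (f j)
      edge i j i≢j ij = (λ fi≡fj → i≢j (f-inj fi≡fj)) , f-col _ _ ij
      k≤codeg : k ≤ codeg χ (f zero) (f (suc zero))
      k≤codeg = subst (k ≤_) (sym (codeg≡count χ _ _))
        (injection⇒≤count (λ v → adj? χ (f zero) v ×-dec adj? χ v (f (suc zero)))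
          (λ i → f (suc (suc i))) (λ e → suc-injective (suc-injective (f-inj e)))
          (λ i → edge zero (suc (suc i)) (λ ()) tt , edge (suc (suc i)) (suc zero) (λ ()) tt))

    codeg≥⇒book : ∀ {x y} → Adj χ x y → k ≤ codeg χ x y → HasCopy χ c (BookAdj k)
    codeg≥⇒book {x} {y} xy k≤codeg
      with ≤count⇒injection (λ v → adj? χ x v ×-dec adj? χ v y) k (subst (k ≤_) (codeg≡count χ x y) k≤codeg)
    ... | g , g-inj , pages = f , f-inj , λ i j ij → proj₂ (f-adj i j ij)
      where
      f : Fin (suc (suc k)) → Fin n
      f = x ∷ᶠ y ∷ᶠ g
      f-adj : ∀ i j → BookAdj k i j → Adj χ (f i) (f j)
      f-adj zero          (suc zero)    _ = xy
      f-adj (suc zero)    zero          _ = Adj-sym xy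
      f-adj zero          (suc (suc j)) _ = proj₁ (pages j)
      f-adj (suc (suc i)) zero          _ = Adj-sym (proj₁ (pages i))
      f-adj (suc zero)    (suc (suc j)) _ = Adj-sym (proj₂ (pages j))
      f-adj (suc (suc i)) (suc zero)    _ = proj₂ (pages i)
      f-inj : Injective _≡_ _≡_ f
      f-inj {zero}        {zero}        _ = refl
      f-inj {suc zero}    {suc zero}    _ = refl
      f-inj {suc (suc i)} {suc (suc j)} e = cong (λ l → suc (suc l)) (g-inj e)
      f-inj {zero}        {suc zero}    e = ⊥-elim (proj₁ (f-adj zero (suc zero) tt) e)
      f-inj {suc zero}    {zero}        e = ⊥-elim (proj₁ (f-adj (suc zero) zero tt) e)
      f-inj {zero}        {suc (suc j)} e = ⊥-elim (proj₁ (f-adj zero (suc (suc j)) tt) e)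
      f-inj {suc (suc i)} {zero}        e = ⊥-elim (proj₁ (f-adj (suc (suc i)) zero tt) e)
      f-inj {suc zero}    {suc (suc j)} e = ⊥-elim (proj₁ (f-adj (suc zero) (suc (suc j)) tt) e)
      f-inj {suc (suc i)} {suc zero}    e = ⊥-elim (proj₁ (f-adj (suc (suc i)) (suc zero) tt) e)

  book-or-codegreeBound : ∀ χ s → HasCopy χ c (BookAdj (suc s)) ⊎ CodegreeBound χ s
  book-or-codegreeBound χ s with any? (λ x → any? (λ y → adj? χ x y ×-dec (suc s ≤? codeg χ x y)))
  ... | yes (x , y , xy , s<codeg) = inj₁ (codeg≥⇒book xy s<codeg)
  ... | no ∄edge                   = inj₂ λ x y xy → ≮⇒≥ λ s<codeg → ∄edge (x , y , xy , s<codeg)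

  codegreeBound⇒¬book : ∀ {χ s} → CodegreeBound χ s → ¬ HasCopy χ c (BookAdj (suc s))
  codegreeBound⇒¬book bound book with book⇒codeg≥ book
  ... | x , y , xy , s<codeg = <⇒≱ s<codeg (bound x y xy)

open ColourGraph using (CodegreeBound; codegreeBound?; book-or-codegreeBound; codegreeBound⇒¬book)

codegreeBounded⇒¬arrows : ∀ {n s t} (c : Colouring n) → CodegreeBound c red s → CodegreeBound c blue t →
                           ¬ Arrows n (BookAdj (suc s)) (BookAdj (suc t))
codegreeBounded⇒¬arrows c red-bound blue-bound arrows with arrows c
... | inj₁ red-book  = codegreeBound⇒¬book c red-bound red-book
... | inj₂ blue-book = codegreeBound⇒¬book c blue-bound blue-book

¬codegreeBounded⇒arrows : ∀ {n s t} →
                          (∀ (c : Colouring n) → CodegreeBound c red s → CodegreeBound c blue t → ⊥) →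
                          Arrows n (BookAdj (suc s)) (BookAdj (suc t))
¬codegreeBounded⇒arrows {s = s} {t} ¬bounded c
  with book-or-codegreeBound c red s | book-or-codegreeBound c blue t
... | inj₁ red-book  | _               = inj₁ red-book
... | inj₂ _         | inj₁ blue-book  = inj₂ blue-book
... | inj₂ red-bound | inj₂ blue-bound = ⊥-elim (¬bounded c red-bound blue-bound)

-- Counting degrees over edges

module DegreeCounting {n} (c : Colouring n) where

  open ColourGraph c hiding (CodegreeBound)

  edgeDegree : Fin n → Fin n → ℕ
  edgeDegree x y = A red x y * deg red x + A blue x y * deg blue y

  edgeDegreeBound : ℕ → ℕ → Fin n → Fin n → ℕ
  edgeDegreeBound s t x y = paths red blue x y + suc s * A red x y + suc t * A blue x y

  ∑-column-* : ∀ χ (h : Fin n → ℕ) y → ∑[ x < n ] (A χ x y * h y) ≡ deg χ y * h y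
  ∑-column-* χ h y = trans (sym (*-distribʳ-sum (h y) (λ x → A χ x y))) (cong (_* h y) (∑-column χ y))

  ∑∑-paths : ∑[ x < n ] ∑[ y < n ] paths red blue x y ≡ ∑[ v < n ] (deg red v * deg blue v)
  ∑∑-paths = begin
    ∑[ x < n ] ∑[ y < n ] ∑[ v < n ] (A red x v * A blue v y)
      ≡⟨ sum-cong-≗ (λ x → ∑-comm (λ y v → A red x v * A blue v y)) ⟩
    ∑[ x < n ] ∑[ v < n ] ∑[ y < n ] (A red x v * A blue v y)
      ≡⟨ sum-cong-≗ (λ x → sum-cong-≗ λ v → sym (*-distribˡ-sum (A red x v) (A blue v))) ⟩
    ∑[ x < n ] ∑[ v < n ] (A red x v * deg blue v)
      ≡⟨ ∑-comm (λ x v → A red x v * deg blue v) ⟩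
    ∑[ v < n ] ∑[ x < n ] (A red x v * deg blue v)
      ≡⟨ sum-cong-≗ (∑-column-* red (deg blue)) ⟩
    ∑[ v < n ] (deg red v * deg blue v) ∎
    where open ≡-Reasoning

  ∑∑-edgeDegree : ∑[ x < n ] ∑[ y < n ] edgeDegree x y ≡
                  ∑[ x < n ] (deg red x * deg red x + deg blue x * deg blue x)
  ∑∑-edgeDegree = begin
    ∑[ x < n ] ∑[ y < n ] (A red x y * deg red x + A blue x y * deg blue y)
      ≡⟨ sum-cong-≗ (λ x → ∑-distrib-+ (λ y → A red x y * deg red x) (λ y → A blue x y * deg blue y)) ⟩
    ∑[ x < n ] (∑[ y < n ] (A red x y * deg red x) + ∑[ y < n ] (A blue x y * deg blue y))
      ≡⟨ ∑-distrib-+ (λ x → ∑[ y < n ] (A red x y * deg red x)) (λ x → ∑[ y < n ] (A blue x y * deg blue y)) ⟩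
    ∑[ x < n ] ∑[ y < n ] (A red x y * deg red x) + ∑[ x < n ] ∑[ y < n ] (A blue x y * deg blue y)
      ≡⟨ cong₂ _+_ (sum-cong-≗ λ x → sym (*-distribʳ-sum (deg red x) (A red x)))
                   (∑-comm (λ x y → A blue x y * deg blue y)) ⟩
    ∑[ x < n ] (deg red x * deg red x) + ∑[ y < n ] ∑[ x < n ] (A blue x y * deg blue y)
      ≡⟨ cong (∑[ x < n ] (deg red x * deg red x) +_) (sum-cong-≗ (∑-column-* blue (deg blue))) ⟩
    ∑[ x < n ] (deg red x * deg red x) + ∑[ y < n ] (deg blue y * deg blue y)
      ≡⟨ sym (∑-distrib-+ (λ x → deg red x * deg red x) (λ x → deg blue x * deg blue x)) ⟩
    ∑[ x < n ] (deg red x * deg red x + deg blue x * deg blue x) ∎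
    where open ≡-Reasoning

  ∑∑-edgeDegreeBound : ∀ s t → ∑[ x < n ] ∑[ y < n ] edgeDegreeBound s t x y ≡
                       ∑[ x < n ] (deg red x * deg blue x + suc s * deg red x + suc t * deg blue x)
  ∑∑-edgeDegreeBound s t = begin
    ∑[ x < n ] ∑[ y < n ] (paths red blue x y + suc s * A red x y + suc t * A blue x y)
      ≡⟨ sum-cong-≗ row ⟩
    ∑[ x < n ] (∑[ y < n ] paths red blue x y + suc s * deg red x + suc t * deg blue x)
      ≡⟨ ∑-distrib-+₃ (λ x → ∑[ y < n ] paths red blue x y) (λ x → suc s * deg red x)
                      (λ x → suc t * deg blue x) ⟩
    ∑[ x < n ] ∑[ y < n ] paths red blue x y + ∑[ x < n ] (suc s * deg red x) + ∑[ x < n ] (suc t * deg blue x)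
      ≡⟨ cong (λ p → p + ∑[ x < n ] (suc s * deg red x) + ∑[ x < n ] (suc t * deg blue x)) ∑∑-paths ⟩
    ∑[ x < n ] (deg red x * deg blue x) + ∑[ x < n ] (suc s * deg red x) + ∑[ x < n ] (suc t * deg blue x)
      ≡⟨ sym (∑-distrib-+₃ (λ x → deg red x * deg blue x) (λ x → suc s * deg red x)
                           (λ x → suc t * deg blue x)) ⟩
    ∑[ x < n ] (deg red x * deg blue x + suc s * deg red x + suc t * deg blue x) ∎
    where
    open ≡-Reasoning
    row : ∀ x → ∑[ y < n ] edgeDegreeBound s t x y ≡
                ∑[ y < n ] paths red blue x y + suc s * deg red x + suc t * deg blue x
    row x = trans (∑-distrib-+₃ (paths red blue x) (λ y → suc s * A red x y) (λ y → suc t * A blue x y))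
                  (cong₂ (λ p q → ∑[ y < n ] paths red blue x y + p + q)
                         (sym (*-distribˡ-sum (suc s) (A red x))) (sym (*-distribˡ-sum (suc t) (A blue x))))

  module _ {x y : Fin n} where

    edgeDegree-red : Adj red x y → edgeDegree x y ≡ codeg red x y + paths red blue x y + 1
    edgeDegree-red xy = begin
      A red x y * deg red x + A blue x y * deg blue y  ≡⟨ cong₂ (λ r b → r * deg red x + b * deg blue y)
                                                                xy∈R (A-other xy) ⟩
      1 * deg red x + 0 * deg blue y                   ≡⟨ trans (+-identityʳ _) (*-identityˡ _) ⟩
      deg red x                                        ≡⟨ sym (deg-split red x y) ⟩
      codeg red x y + paths red blue x y + A red x y   ≡⟨ cong (codeg red x y + paths red blue x y +_) xy∈R ⟩
      codeg red x y + paths red blue x y + 1           ∎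
      where
      open ≡-Reasoning
      xy∈R : A red x y ≡ 1
      xy∈R = 𝟙-yes (adj? red x y) xy

    edgeDegree-blue : Adj blue x y → edgeDegree x y ≡ codeg blue x y + paths red blue x y + 1
    edgeDegree-blue xy = begin
      A red x y * deg red x + A blue x y * deg blue y  ≡⟨ cong₂ (λ r b → r * deg red x + b * deg blue y)
                                                                (A-other xy) xy∈B ⟩
      0 * deg red x + 1 * deg blue y                   ≡⟨ *-identityˡ _ ⟩
      deg blue y                                       ≡⟨ sym (deg-split′ blue x y) ⟩
      codeg blue x y + paths red blue x y + A blue x y ≡⟨ cong (codeg blue x y + paths red blue x y +_) xy∈B ⟩
      codeg blue x y + paths red blue x y + 1          ∎
      where
      open ≡-Reasoning
      xy∈B : A blue x y ≡ 1
      xy∈B = 𝟙-yes (adj? blue x y) xy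

    edgeDegreeBound-red : ∀ s t → Adj red x y → edgeDegreeBound s t x y ≡ s + paths red blue x y + 1
    edgeDegreeBound-red s t xy = trans
      (cong₂ (λ r b → paths red blue x y + suc s * r + suc t * b) (𝟙-yes (adj? red x y) xy) (A-other xy))
      (arith (paths red blue x y) s t)
      where
      arith : ∀ m s t → m + suc s * 1 + suc t * 0 ≡ s + m + 1
      arith = solve-∀

    edgeDegreeBound-blue : ∀ s t → Adj blue x y → edgeDegreeBound s t x y ≡ t + paths red blue x y + 1
    edgeDegreeBound-blue s t xy = trans
      (cong₂ (λ r b → paths red blue x y + suc s * r + suc t * b) (A-other xy) (𝟙-yes (adj? blue x y) xy))
      (arith (paths red blue x y) s t)
      where
      arith : ∀ m s t → m + suc s * 0 + suc t * 1 ≡ t + m + 1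
      arith = solve-∀

  module _ {s t} (red-bound : CodegreeBound c red s) (blue-bound : CodegreeBound c blue t) where

    edgeDegree≤ : ∀ x y → edgeDegree x y ≤ edgeDegreeBound s t x y
    edgeDegree≤ x y with edge-cases x y
    ... | inj₁ refl = subst (_≤ edgeDegreeBound s t x x)
                            (sym (cong₂ (λ r b → r * deg red x + b * deg blue x) (A-irrefl x) (A-irrefl x))) z≤n
    ... | inj₂ (inj₁ xy) = subst₂ _≤_ (sym (edgeDegree-red xy)) (sym (edgeDegreeBound-red s t xy))
                             (+-monoˡ-≤ 1 (+-monoˡ-≤ (paths red blue x y) (red-bound x y xy)))
    ... | inj₂ (inj₂ xy) = subst₂ _≤_ (sym (edgeDegree-blue xy)) (sym (edgeDegreeBound-blue s t xy))
                             (+-monoˡ-≤ 1 (+-monoˡ-≤ (paths red blue x y) (blue-bound x y xy)))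

    degree-inequality : ∑[ x < n ] (deg red x * deg red x + deg blue x * deg blue x) ≤
                        ∑[ x < n ] (deg red x * deg blue x + suc s * deg red x + suc t * deg blue x)
    degree-inequality =
      subst₂ _≤_ ∑∑-edgeDegree (∑∑-edgeDegreeBound s t) (∑-mono-≤ λ x → ∑-mono-≤ (edgeDegree≤ x))

    degree-inequality-tight :
      ∑[ x < n ] (deg red x * deg blue x + suc s * deg red x + suc t * deg blue x) ≤
      ∑[ x < n ] (deg red x * deg red x + deg blue x * deg blue x) →
      (∀ x y → Adj red x y → codeg red x y ≡ s) × (∀ x y → Adj blue x y → codeg blue x y ≡ t)
    degree-inequality-tight sums≥ = red-tight , blue-tight
      where
      tight : ∀ x y → edgeDegree x y ≡ edgeDegreeBound s t x y
      tight = ∑∑-squeeze edgeDegree≤ (subst₂ _≤_ (sym (∑∑-edgeDegreeBound s t)) (sym ∑∑-edgeDegree) sums≥)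
      red-tight : ∀ x y → Adj red x y → codeg red x y ≡ s
      red-tight x y xy = +-cancelʳ-≡ (paths red blue x y) _ _ (+-cancelʳ-≡ 1 _ _
        (trans (sym (edgeDegree-red xy)) (trans (tight x y) (edgeDegreeBound-red s t xy))))
      blue-tight : ∀ x y → Adj blue x y → codeg blue x y ≡ t
      blue-tight x y xy = +-cancelʳ-≡ (paths red blue x y) _ _ (+-cancelʳ-≡ 1 _ _
        (trans (sym (edgeDegree-blue xy)) (trans (tight x y) (edgeDegreeBound-blue s t xy))))

-- Closed walks and the necklace congruence

rotˡ : ∀ {a} {A : Set a} {k} → Vec A (suc k) → Vec A (suc k)
rotˡ (x ∷ v) = v ∷ʳ x

rotate : ∀ {a} {A : Set a} {k} → ℕ → Vec A (suc k) → Vec A (suc k)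
rotate m w = fold w rotˡ m

∑ᵛ : ∀ {n} k → (Vec (Fin n) k → ℕ) → ℕ
∑ᵛ     zero    g = g []
∑ᵛ {n} (suc k) g = ∑[ x < n ] ∑ᵛ k (λ v → g (x ∷ v))

module _ {n : ℕ} where

  ∑ᵛ-cong : ∀ k {f g : Vec (Fin n) k → ℕ} → (∀ v → f v ≡ g v) → ∑ᵛ k f ≡ ∑ᵛ k g
  ∑ᵛ-cong zero    f≗g = f≗g []
  ∑ᵛ-cong (suc k) f≗g = sum-cong-≗ λ x → ∑ᵛ-cong k (λ v → f≗g (x ∷ v))

  ∑ᵛ-*ˡ : ∀ k m (g : Vec (Fin n) k → ℕ) → ∑ᵛ k (λ v → m * g v) ≡ m * ∑ᵛ k g
  ∑ᵛ-*ˡ zero    m g = refl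
  ∑ᵛ-*ˡ (suc k) m g = trans (sum-cong-≗ λ x → ∑ᵛ-*ˡ k m (λ v → g (x ∷ v)))
                            (sym (*-distribˡ-sum m (λ x → ∑ᵛ k (λ v → g (x ∷ v)))))

  ∑ᵛ-∑-comm : ∀ k {m} (G : Fin m → Vec (Fin n) k → ℕ) →
              ∑ᵛ k (λ v → ∑[ j < m ] G j v) ≡ ∑[ j < m ] ∑ᵛ k (G j)
  ∑ᵛ-∑-comm zero    G = refl
  ∑ᵛ-∑-comm (suc k) G = trans (sum-cong-≗ λ x → ∑ᵛ-∑-comm k (λ j v → G j (x ∷ v)))
                              (∑-comm λ x j → ∑ᵛ k (λ v → G j (x ∷ v)))

  ∑ᵛ-∷ʳ : ∀ k (g : Vec (Fin n) (suc k) → ℕ) → ∑ᵛ (suc k) g ≡ ∑ᵛ k (λ v → ∑[ x < n ] g (v ∷ʳ x))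
  ∑ᵛ-∷ʳ zero    g = refl
  ∑ᵛ-∷ʳ (suc k) g = sum-cong-≗ λ y → ∑ᵛ-∷ʳ k (λ v → g (y ∷ v))

  ∑ᵛ-rotˡ : ∀ k (g : Vec (Fin n) (suc k) → ℕ) → ∑ᵛ (suc k) (λ w → g (rotˡ w)) ≡ ∑ᵛ (suc k) g
  ∑ᵛ-rotˡ k g = trans (sym (∑ᵛ-∑-comm k (λ x v → g (v ∷ʳ x)))) (sym (∑ᵛ-∷ʳ k g))

  ∑ᵛ-rotate : ∀ k m (g : Vec (Fin n) (suc k) → ℕ) → ∑ᵛ (suc k) (λ w → g (rotate m w)) ≡ ∑ᵛ (suc k) g
  ∑ᵛ-rotate k zero    g = refl
  ∑ᵛ-rotate k (suc m) g = trans (∑ᵛ-rotate k m (λ w → g (rotˡ w))) (∑ᵛ-rotˡ k g)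

invertible-mod-7 : ∀ d → 0 < d → d < 7 → ∃ λ k → (k * d) mod 7 ≡ suc zero
invertible-mod-7 1 _ _ = 1 , refl
invertible-mod-7 2 _ _ = 4 , refl
invertible-mod-7 3 _ _ = 5 , refl
invertible-mod-7 4 _ _ = 2 , refl
invertible-mod-7 5 _ _ = 3 , refl
invertible-mod-7 6 _ _ = 6 , refl
invertible-mod-7 (suc (suc (suc (suc (suc (suc (suc _))))))) _ (s≤s (s≤s (s≤s (s≤s (s≤s (s≤s (s≤s ())))))))

module _ {a} {A : Set a} where

  rotate-+ : ∀ i j (w : Vec A 7) → rotate (i + j) w ≡ rotate i (rotate j w)
  rotate-+ i j w = fold-+ w rotˡ i

  rotate-7 : (w : Vec A 7) → rotate 7 w ≡ w
  rotate-7 (_ ∷ _ ∷ _ ∷ _ ∷ _ ∷ _ ∷ _ ∷ []) = refl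

  rotate-*7 : ∀ q (w : Vec A 7) → rotate (q * 7) w ≡ w
  rotate-*7 zero    w = refl
  rotate-*7 (suc q) w = trans (rotate-+ 7 (q * 7) w) (trans (cong (rotate 7) (rotate-*7 q w)) (rotate-7 w))

  rotate-multiple : ∀ d k (w : Vec A 7) → rotate d w ≡ w → rotate (k * d) w ≡ w
  rotate-multiple d zero    w fixed = refl
  rotate-multiple d (suc k) w fixed =
    trans (rotate-+ d (k * d) w) (trans (cong (rotate d) (rotate-multiple d k w fixed)) fixed)

  orbit : Vec A 7 → Fin 7 → Vec A 7
  orbit w j = rotate (toℕ j) w

  rotate≡orbit : ∀ m (w : Vec A 7) → rotate m w ≡ orbit w (m mod 7)
  rotate≡orbit m w = begin
    rotate m w                              ≡⟨ cong (λ i → rotate i w) (m≡m%n+[m/n]*n m 7) ⟩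
    rotate (m % 7 + m / 7 * 7) w            ≡⟨ rotate-+ (m % 7) (m / 7 * 7) w ⟩
    rotate (m % 7) (rotate (m / 7 * 7) w)   ≡⟨ cong (rotate (m % 7)) (rotate-*7 (m / 7) w) ⟩
    rotate (m % 7) w                        ≡⟨ cong (λ i → rotate i w) (sym (toℕ-fromℕ< (m%n<n m 7))) ⟩
    orbit w (m mod 7)                       ∎
    where open ≡-Reasoning

  orbit-orbit : ∀ (w : Vec A 7) j i → orbit (orbit w j) i ≡ orbit w ((toℕ i + toℕ j) mod 7)
  orbit-orbit w j i = trans (sym (rotate-+ (toℕ i) (toℕ j) w)) (rotate≡orbit (toℕ i + toℕ j) w)

  orbit-in-orbit : ∀ (w : Vec A 7) j i → orbit w i ≡ orbit (orbit w j) ((toℕ i + 6 * toℕ j) mod 7)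
  orbit-in-orbit w j i = begin
    rotate (toℕ i) w                              ≡⟨ cong (rotate (toℕ i)) (sym (rotate-*7 (toℕ j) w)) ⟩
    rotate (toℕ i) (rotate (toℕ j * 7) w)         ≡⟨ sym (rotate-+ (toℕ i) (toℕ j * 7) w) ⟩
    rotate (toℕ i + toℕ j * 7) w                  ≡⟨ cong (λ m → rotate m w) (arith (toℕ i) (toℕ j)) ⟩
    rotate (toℕ i + 6 * toℕ j + toℕ j) w          ≡⟨ rotate-+ (toℕ i + 6 * toℕ j) (toℕ j) w ⟩
    rotate (toℕ i + 6 * toℕ j) (orbit w j)        ≡⟨ rotate≡orbit (toℕ i + 6 * toℕ j) (orbit w j) ⟩
    orbit (orbit w j) ((toℕ i + 6 * toℕ j) mod 7) ∎
    where
    open ≡-Reasoning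
    arith : ∀ i j → i + j * 7 ≡ i + 6 * j + j
    arith = solve-∀

  periodic⇒rotˡ-fixed : ∀ d (w : Vec A 7) → 0 < d → d < 7 → rotate d w ≡ w → rotˡ w ≡ w
  periodic⇒rotˡ-fixed d w 0<d d<7 fixed with invertible-mod-7 d 0<d d<7
  ... | k , kd≡1 = begin
    rotˡ w                    ≡⟨⟩
    orbit w (suc zero)        ≡⟨ cong (orbit w) (sym kd≡1) ⟩
    orbit w ((k * d) mod 7)   ≡⟨ sym (rotate≡orbit (k * d) w) ⟩
    rotate (k * d) w          ≡⟨ rotate-multiple d k w fixed ⟩
    w                         ∎
    where open ≡-Reasoning

  rotations-collide⇒rotˡ-fixed : ∀ p q (w : Vec A 7) → p < q → q < 7 →
                                 rotate p w ≡ rotate q w → rotˡ w ≡ w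
  rotations-collide⇒rotˡ-fixed p q w p<q q<7 wₚ≡w_q = periodic⇒rotˡ-fixed (7 ∸ q + p) w
    (≤-trans (m<n⇒0<n∸m q<7) (m≤m+n (7 ∸ q) p))
    (subst (7 ∸ q + p <_) (m∸n+n≡m (<⇒≤ q<7)) (+-monoʳ-< (7 ∸ q) p<q))
    (begin
      rotate (7 ∸ q + p) w        ≡⟨ rotate-+ (7 ∸ q) p w ⟩
      rotate (7 ∸ q) (rotate p w) ≡⟨ cong (rotate (7 ∸ q)) wₚ≡w_q ⟩
      rotate (7 ∸ q) (rotate q w) ≡⟨ sym (rotate-+ (7 ∸ q) q w) ⟩
      rotate (7 ∸ q + q) w        ≡⟨ cong (λ i → rotate i w) (m∸n+n≡m (<⇒≤ q<7)) ⟩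
      rotate 7 w                  ≡⟨ rotate-7 w ⟩
      w                           ∎)
    where open ≡-Reasoning

  orbit-injective : (w : Vec A 7) → rotˡ w ≢ w → Injective _≡_ _≡_ (orbit w)
  orbit-injective w aperiodic {i} {j} wᵢ≡wⱼ with <-cmp (toℕ i) (toℕ j)
  ... | tri< i<j _ _ = ⊥-elim (aperiodic (rotations-collide⇒rotˡ-fixed _ _ w i<j (toℕ<n j) wᵢ≡wⱼ))
  ... | tri≈ _ i≡j _ = toℕ-injective i≡j
  ... | tri> _ _ j<i = ⊥-elim (aperiodic (rotations-collide⇒rotˡ-fixed _ _ w j<i (toℕ<n i) (sym wᵢ≡wⱼ)))

module _ {c ℓ₁ ℓ₂} (O : DecTotalOrder c ℓ₁ ℓ₂) where

  open DecTotalOrder O using (Carrier; _≈_; antisym; totalOrder) renaming (_≤_ to _≼_; _≤?_ to _≼?_)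
  open import Data.List.Extrema totalOrder using (argmin; f[argmin]≤f[xs])

  count-minima : ∀ {m} (f : Fin (suc m) → Carrier) → (∀ {i j} → f i ≈ f j → i ≡ j) →
                 count (λ j → all? λ i → f j ≼? f i) ≡ 1
  count-minima {m} f f-inj = begin
    ∑[ j < suc m ] 𝟙 (all? λ i → f j ≼? f i)  ≡⟨ sum-cong-≗ (λ j → 𝟙-cong (all? λ i → f j ≼? f i) (j ≟ j₀)
                                                                          is-j₀ j₀-is) ⟩
    ∑[ j < suc m ] δ j j₀                     ≡⟨ sum-cong-≗ (λ j → sym (*-identityˡ (δ j j₀))) ⟩
    ∑[ j < suc m ] (1 * δ j j₀)               ≡⟨ ∑-δ (λ _ → 1) j₀ ⟩
    1                                         ∎
    where
    open ≡-Reasoning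
    j₀ : Fin (suc m)
    j₀ = argmin f zero (allFin (suc m))
    j₀-min : ∀ i → f j₀ ≼ f i
    j₀-min i = All.lookup (f[argmin]≤f[xs] zero (allFin (suc m))) (∈-allFin i)
    is-j₀ : ∀ {j} → (∀ i → f j ≼ f i) → j ≡ j₀
    is-j₀ {j} j-min = f-inj (antisym (j-min j₀) (j₀-min j))
    j₀-is : ∀ {j} → j ≡ j₀ → ∀ i → f j ≼ f i
    j₀-is refl = j₀-min

module _ {n : ℕ} where

  lexOrder : DecTotalOrder _ _ _
  lexOrder = Lex.≤-decTotalOrder (≤-decTotalOrder n) 7

  open DecTotalOrder lexOrder using () renaming (_≤_ to _≤ₗ_; _≤?_ to _≤ₗ?_)

  Minimal : Vec (Fin n) 7 → Set
  Minimal w = ∀ j → w ≤ₗ orbit w j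

  minimal? : ∀ w → Dec (Minimal w)
  minimal? w = all? λ j → w ≤ₗ? orbit w j

  count-minimal-rotations : (w : Vec (Fin n) 7) → rotˡ w ≢ w → ∑[ j < 7 ] 𝟙 (minimal? (orbit w j)) ≡ 1
  count-minimal-rotations w aperiodic = trans
    (sum-cong-≗ λ j → 𝟙-cong (minimal? (orbit w j)) (all? λ i → orbit w j ≤ₗ? orbit w i) (to j) (from j))
    (count-minima lexOrder (orbit w) (λ wᵢ≈wⱼ → orbit-injective w aperiodic (Pointwise-≡⇒≡ wᵢ≈wⱼ)))
    where
    to : ∀ j → Minimal (orbit w j) → ∀ i → orbit w j ≤ₗ orbit w i
    to j wⱼ-min i = subst (orbit w j ≤ₗ_) (sym (orbit-in-orbit w j i)) (wⱼ-min ((toℕ i + 6 * toℕ j) mod 7))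
    from : ∀ j → (∀ i → orbit w j ≤ₗ orbit w i) → Minimal (orbit w j)
    from j wⱼ-min i = subst (orbit w j ≤ₗ_) (sym (orbit-orbit w j i)) (wⱼ-min ((toℕ i + toℕ j) mod 7))

  -- Each aperiodic orbit contains exactly one lexicographically minimal vector, so weighting F by the
  -- indicator M of minimality and summing over the orbit recovers F; the sum then splits into
  -- seven copies of Σ F·M.
  necklace : (F : Vec (Fin n) 7 → ℕ) → (∀ w → F (rotˡ w) ≡ F w) → (∀ w → rotˡ w ≡ w → F w ≡ 0) →
             7 ∣ ∑ᵛ 7 F
  necklace F F-rotˡ F-fixed = subst (7 ∣_) (sym orbit-sum) (m∣m*n (∑ᵛ 7 (λ w → F w * M w)))
    where
    open ≡-Reasoning
    M : Vec (Fin n) 7 → ℕ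
    M w = 𝟙 (minimal? w)
    F-rotate : ∀ m w → F (rotate m w) ≡ F w
    F-rotate zero    w = refl
    F-rotate (suc m) w = trans (F-rotˡ (rotate m w)) (F-rotate m w)
    F-split : ∀ w → F w ≡ ∑[ j < 7 ] (F w * M (orbit w j))
    F-split w with ≡-dec _≟_ (rotˡ w) w
    ... | yes fixed    = trans (F-fixed w fixed)
                               (trans (cong (_* ∑[ j < 7 ] M (orbit w j)) (sym (F-fixed w fixed)))
                                      (*-distribˡ-sum (F w) (λ j → M (orbit w j))))
    ... | no aperiodic = trans (sym (trans (cong (F w *_) (count-minimal-rotations w aperiodic)) (*-identityʳ (F w))))
                               (*-distribˡ-sum (F w) (λ j → M (orbit w j)))
    orbit-sum : ∑ᵛ 7 F ≡ 7 * ∑ᵛ 7 (λ w → F w * M w)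
    orbit-sum = begin
      ∑ᵛ 7 F
        ≡⟨ ∑ᵛ-cong 7 F-split ⟩
      ∑ᵛ 7 (λ w → ∑[ j < 7 ] (F w * M (orbit w j)))
        ≡⟨ ∑ᵛ-∑-comm 7 (λ j w → F w * M (orbit w j)) ⟩
      ∑[ j < 7 ] ∑ᵛ 7 (λ w → F w * M (orbit w j))
        ≡⟨ sum-cong-≗ (λ j → ∑ᵛ-cong 7 λ w → cong (_* M (orbit w j)) (sym (F-rotate (toℕ j) w))) ⟩
      ∑[ j < 7 ] ∑ᵛ 7 (λ w → F (orbit w j) * M (orbit w j))
        ≡⟨ sum-cong-≗ (λ (j : Fin 7) → ∑ᵛ-rotate 6 (toℕ j) (λ w → F w * M w)) ⟩
      ∑[ j < 7 ] ∑ᵛ 7 (λ w → F w * M w)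
        ≡⟨ ∑-const 7 (∑ᵛ 7 (λ w → F w * M w)) ⟩
      7 * ∑ᵛ 7 (λ w → F w * M w) ∎

module Walks {n} (a : Fin n → Fin n → ℕ) where

  pathWeight : ∀ {k} → Fin n → Vec (Fin n) k → Fin n → ℕ
  pathWeight x []      y = a x y
  pathWeight x (z ∷ v) y = a x z * pathWeight z v y

  -- The (x, y) entry of a^(k+1): the k inner vertices of the walks are summed over.
  walks : ℕ → Fin n → Fin n → ℕ
  walks k x y = ∑ᵛ k (λ v → pathWeight x v y)

  walks-suc : ∀ k x y → walks (suc k) x y ≡ ∑[ z < n ] (a x z * walks k z y)
  walks-suc k x y = sum-cong-≗ λ z → ∑ᵛ-*ˡ k (a x z) (λ v → pathWeight z v y)

  pathWeight-∷ʳ : ∀ {k} x (v : Vec (Fin n) k) z y → pathWeight x (v ∷ʳ z) y ≡ pathWeight x v z * a z y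
  pathWeight-∷ʳ x []      z y = refl
  pathWeight-∷ʳ x (u ∷ v) z y =
    trans (cong (a x u *_) (pathWeight-∷ʳ u v z y)) (sym (*-assoc (a x u) (pathWeight u v z) (a z y)))

  closedWeight : ∀ {k} → Vec (Fin n) (suc k) → ℕ
  closedWeight (x ∷ v) = pathWeight x v x

  closedWeight-rotˡ : ∀ {k} (w : Vec (Fin n) (suc k)) → closedWeight (rotˡ w) ≡ closedWeight w
  closedWeight-rotˡ (x ∷ [])    = refl
  closedWeight-rotˡ (x ∷ y ∷ v) = trans (pathWeight-∷ʳ y v x y) (*-comm (pathWeight y v x) (a x y))

  module _ (a-irrefl : ∀ x → a x x ≡ 0) where

    closedWeight-fixed : ∀ {k} (w : Vec (Fin n) (suc (suc k))) → rotˡ w ≡ w → closedWeight w ≡ 0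
    closedWeight-fixed (x ∷ y ∷ v) fixed with ∷-injectiveˡ fixed
    ... | refl = cong (_* pathWeight x v x) (a-irrefl x)

    7∣closedWalks : 7 ∣ ∑[ x < n ] walks 6 x x
    7∣closedWalks = necklace closedWeight closedWeight-rotˡ closedWeight-fixed

  module _ {d e f : ℕ} (row-sum : ∀ x → ∑[ z < n ] a x z ≡ d)
           (square : ∀ x y → ∑[ z < n ] (a x z * a z y) ≡ e * δ x y + f) where

    -- (p , q , r) stands for the matrix pI + qJ + ra, with J the all-ones matrix.
    ⟦_⟧ : ℕ × ℕ × ℕ → Fin n → Fin n → ℕ
    ⟦ p , q , r ⟧ x y = p * δ x y + q + r * a x y

    a·_ : ℕ × ℕ × ℕ → ℕ × ℕ × ℕ
    a· (p , q , r) = e * r , d * q + f * r , p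

    a·-correct : ∀ t x y → ∑[ z < n ] (a x z * ⟦ t ⟧ z y) ≡ ⟦ a· t ⟧ x y
    a·-correct (p , q , r) x y = begin
      ∑[ z < n ] (a x z * (p * δ z y + q + r * a z y))
        ≡⟨ sum-cong-≗ (λ z → expand (a x z) p q r (δ z y) (a z y)) ⟩
      ∑[ z < n ] (p * (a x z * δ z y) + q * a x z + r * (a x z * a z y))
        ≡⟨ ∑-distrib-+₃ (λ z → p * (a x z * δ z y)) (λ z → q * a x z) (λ z → r * (a x z * a z y)) ⟩
      ∑[ z < n ] (p * (a x z * δ z y)) + ∑[ z < n ] (q * a x z) + ∑[ z < n ] (r * (a x z * a z y))
        ≡⟨ sym (cong₂ _+_ (cong₂ _+_ (*-distribˡ-sum p (λ z → a x z * δ z y)) (*-distribˡ-sum q (a x)))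
                                     (*-distribˡ-sum r (λ z → a x z * a z y))) ⟩
      p * ∑[ z < n ] (a x z * δ z y) + q * ∑[ z < n ] a x z + r * ∑[ z < n ] (a x z * a z y)
        ≡⟨ cong₂ _+_ (cong₂ _+_ (cong (p *_) (∑-δ (a x) y)) (cong (q *_) (row-sum x)))
                     (cong (r *_) (square x y)) ⟩
      p * a x y + q * d + r * (e * δ x y + f)
        ≡⟨ collect d e f p q r (a x y) (δ x y) ⟩
      e * r * δ x y + (d * q + f * r) + p * a x y ∎
      where
      open ≡-Reasoning
      expand : ∀ b p q r δ c → b * (p * δ + q + r * c) ≡ p * (b * δ) + q * b + r * (b * c)
      expand = solve-∀
      collect : ∀ d e f p q r b δ → p * b + q * d + r * (e * δ + f) ≡ e * r * δ + (d * q + f * r) + p * b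
      collect = solve-∀

    walks-closed-form : ∀ k x y → walks k x y ≡ ⟦ fold (0 , 0 , 1) a·_ k ⟧ x y
    walks-closed-form zero    x y = sym (+-identityʳ (a x y))
    walks-closed-form (suc k) x y = begin
      walks (suc k) x y                                    ≡⟨ walks-suc k x y ⟩
      ∑[ z < n ] (a x z * walks k z y)                     ≡⟨ sum-cong-≗ (λ z → cong (a x z *_)
                                                                (walks-closed-form k z y)) ⟩
      ∑[ z < n ] (a x z * ⟦ fold (0 , 0 , 1) a·_ k ⟧ z y) ≡⟨ a·-correct (fold (0 , 0 , 1) a·_ k) x y ⟩
      ⟦ fold (0 , 0 , 1) a·_ (suc k) ⟧ x y                 ∎
      where open ≡-Reasoning

    trace-walks : (∀ x → a x x ≡ 0) → ∀ k {p q r} → fold (0 , 0 , 1) a·_ k ≡ (p , q , r) →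
                  ∑[ x < n ] walks k x x ≡ n * (p + q)
    trace-walks a-irrefl k {p} {q} {r} coeffs = begin
      ∑[ x < n ] walks k x x                  ≡⟨ sum-cong-≗ (λ x → trans (walks-closed-form k x x)
                                                                        (cong (λ t → ⟦ t ⟧ x x) coeffs)) ⟩
      ∑[ x < n ] (p * δ x x + q + r * a x x)  ≡⟨ sum-cong-≗ (λ x → cong₂ (λ i o → p * i + q + r * o)
                                                                         (δ-refl x) (a-irrefl x)) ⟩
      ∑[ x < n ] (p * 1 + q + r * 0)          ≡⟨ ∑-const n _ ⟩
      n * (p * 1 + q + r * 0)                 ≡⟨ cong (n *_) (diagonal p q r) ⟩
      n * (p + q)                             ∎
      where
      open ≡-Reasoning
      diagonal : ∀ p q r → p * 1 + q + r * 0 ≡ p + q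
      diagonal = solve-∀

no-srg-23-12-6-6 : (a : Fin 23 → Fin 23 → ℕ) → (∀ x → a x x ≡ 0) → (∀ x → ∑[ z < 23 ] a x z ≡ 12) →
                   (∀ x y → ∑[ z < 23 ] (a x z * a z y) ≡ 6 * δ x y + 6) → ⊥
no-srg-23-12-6-6 a a-irrefl row-sum square =
  from-no (7 ∣? 23 * (0 + 1557792)) (subst (7 ∣_) closed-walks (7∣closedWalks a-irrefl))
  where
  open Walks a
  closed-walks : ∑[ x < 23 ] walks 6 x x ≡ 23 * (0 + 1557792)
  closed-walks = trace-walks {e = 6} {f = 6} row-sum square a-irrefl 6 refl

-- The lower bound

-- Vertex 7a + i of K₂₁ is the residue i ∈ ℤ₇ in block a; the colour of xy depends only on the
-- blocks of x and y and on y − x mod 7.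
redOffsets : ℕ → ℕ → List ℕ
redOffsets 0 0 = 1 ∷ 2 ∷ 5 ∷ 6 ∷ []
redOffsets 0 1 = 0 ∷ 5 ∷ []
redOffsets 0 2 = 0 ∷ 1 ∷ []
redOffsets 1 0 = 0 ∷ 2 ∷ []
redOffsets 1 1 = 2 ∷ 3 ∷ 4 ∷ 5 ∷ []
redOffsets 1 2 = 0 ∷ 3 ∷ []
redOffsets 2 0 = 0 ∷ 6 ∷ []
redOffsets 2 1 = 0 ∷ 4 ∷ []
redOffsets _ _ = 1 ∷ 3 ∷ 4 ∷ 6 ∷ []

col₂₁ : Fin 21 → Fin 21 → Colour
col₂₁ x y = if any (offset ≡ᵇ_) (redOffsets (toℕ x / 7) (toℕ y / 7)) then red else blue
  where
  offset : ℕ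
  offset = (toℕ y + 7 ∸ toℕ x % 7) % 7

colouring₂₁ : Colouring 21
colouring₂₁ = record
  { col = col₂₁
  ; sym = from-yes (all? λ x → all? λ y → col₂₁ x y ≟ᶜ col₂₁ y x)
  }

colouring₂₁-red : CodegreeBound colouring₂₁ red 3
colouring₂₁-red = from-yes (codegreeBound? colouring₂₁ red 3)

colouring₂₁-blue : CodegreeBound colouring₂₁ blue 6
colouring₂₁-blue = from-yes (codegreeBound? colouring₂₁ blue 6)

-- The upper bound

-- If r + b = 22 then r² + b² − (rb + 4r + 7b) = 3(r − 10)(r − 11).
DegreeQuadratic : ℕ → ℕ → Set
DegreeQuadratic r b =
  (r * b + 4 * r + 7 * b ≤ r * r + b * b) × (r * b + 4 * r + 7 * b ≡ r * r + b * b → r ≡ 10 ⊎ r ≡ 11)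

degreeQuadratic : ∀ r b → r + b ≡ 22 → DegreeQuadratic r b
degreeQuadratic r b r+b≡22 = subst (DegreeQuadratic r) b≡22∸r (from-yes (allUpTo? check 23) r<23)
  where
  check : ∀ r → Dec (DegreeQuadratic r (22 ∸ r))
  check r = let b = 22 ∸ r in
    (r * b + 4 * r + 7 * b ≤? r * r + b * b) ×-dec
    ((r * b + 4 * r + 7 * b ≟ℕ r * r + b * b) →-dec ((r ≟ℕ 10) ⊎-dec (r ≟ℕ 11)))
  r<23 : r < 23
  r<23 = s≤s (subst (r ≤_) r+b≡22 (m≤m+n r b))
  b≡22∸r : 22 ∸ r ≡ b
  b≡22∸r = trans (cong (_∸ r) (sym r+b≡22)) (m+n∸m≡n r b)

module BookFree₂₃ (c : Colouring 23) (red-bound : CodegreeBound c red 3) (blue-bound : CodegreeBound c blue 6)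
  where

  open ColourGraph c hiding (CodegreeBound)
  open DegreeCounting c

  red+blue≡22 : ∀ x → deg red x + deg blue x ≡ 22
  red+blue≡22 x = +-cancelʳ-≡ 1 _ _ (deg-sum red x)

  degree-quadratic : ∀ x → DegreeQuadratic (deg red x) (deg blue x)
  degree-quadratic x = degreeQuadratic _ _ (red+blue≡22 x)

  codeg-exact : (∀ x y → Adj red x y → codeg red x y ≡ 3) × (∀ x y → Adj blue x y → codeg blue x y ≡ 6)
  codeg-exact = degree-inequality-tight red-bound blue-bound (∑-mono-≤ λ x → proj₁ (degree-quadratic x))

  red-deg-10-or-11 : ∀ x → deg red x ≡ 10 ⊎ deg red x ≡ 11
  red-deg-10-or-11 x = proj₂ (degree-quadratic x)
    (∑-squeeze (λ x → proj₁ (degree-quadratic x)) (degree-inequality red-bound blue-bound) x)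

  red-parity : ∀ x → 2 ∣ 3 * deg red x
  red-parity = codeg≡k⇒2∣k*deg red 3 (proj₁ codeg-exact)

  red-regular : ∀ x → deg red x ≡ 10
  red-regular x = [ id , (λ d≡11 → ⊥-elim (from-no (2 ∣? 33) (subst (λ d → 2 ∣ 3 * d) d≡11 (red-parity x)))) ]′
                  (red-deg-10-or-11 x)

  blue-regular : ∀ x → deg blue x ≡ 12
  blue-regular x = +-cancelˡ-≡ 10 _ _ (trans (cong (_+ deg blue x) (sym (red-regular x))) (red+blue≡22 x))

  blue-codeg : ∀ x y → codeg blue x y ≡ 6 * δ x y + 6
  blue-codeg x y = [ diagonal , [ red-edge , blue-edge ]′ ]′ (edge-cases x y)
    where
    off-diagonal : x ≢ y → codeg blue x y ≡ 6 → codeg blue x y ≡ 6 * δ x y + 6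
    off-diagonal x≢y codeg≡6 = trans codeg≡6 (cong (λ i → 6 * i + 6) (sym (𝟙-no (x ≟ y) x≢y)))
    diagonal : x ≡ y → codeg blue x y ≡ 6 * δ x y + 6
    diagonal refl = trans (codeg-diag blue x) (trans (blue-regular x) (cong (λ i → 6 * i + 6) (sym (δ-refl x))))
    blue-edge : Adj blue x y → codeg blue x y ≡ 6 * δ x y + 6
    blue-edge xy = off-diagonal (proj₁ xy) (proj₂ codeg-exact x y xy)
    red-edge : Adj red x y → codeg blue x y ≡ 6 * δ x y + 6
    red-edge xy = off-diagonal (proj₁ xy) codeg≡6
      where
      open ≡-Reasoning
      paths≡6 : paths red blue y x ≡ 6
      paths≡6 = +-cancelˡ-≡ 3 _ _ (+-cancelʳ-≡ 1 _ _ (begin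
        3 + paths red blue y x + 1                      ≡⟨ cong₂ (λ k r → k + paths red blue y x + r)
                                                                 (sym (proj₁ codeg-exact y x (Adj-sym xy)))
                                                                 (sym (𝟙-yes (adj? red y x) (Adj-sym xy))) ⟩
        codeg red y x + paths red blue y x + A red y x  ≡⟨ deg-split red y x ⟩
        deg red y                                       ≡⟨ red-regular y ⟩
        10                                              ∎))
      codeg≡6 : codeg blue x y ≡ 6
      codeg≡6 = +-cancelʳ-≡ 6 _ _ (begin
        codeg blue x y + 6                                ≡⟨ sym (+-identityʳ _) ⟩
        codeg blue x y + 6 + 0                            ≡⟨ cong₂ (λ p b → codeg blue x y + p + b)
                                                                   (sym (trans (paths-reverse blue red x y) paths≡6))
                                                                   (sym (A-other xy)) ⟩
        codeg blue x y + paths blue red x y + A blue x y  ≡⟨ deg-split blue x y ⟩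
        deg blue x                                        ≡⟨ blue-regular x ⟩
        12                                                ∎)

  impossible : ⊥
  impossible = no-srg-23-12-6-6 (A blue) A-irrefl blue-regular blue-codeg

mainTheorem7 : (¬ Arrows 21 (BookAdj 4) (BookAdj 7)) × Arrows 23 (BookAdj 4) (BookAdj 7)
mainTheorem7 =
    codegreeBounded⇒¬arrows colouring₂₁ colouring₂₁-red colouring₂₁-blue
  , ¬codegreeBounded⇒arrows BookFree₂₃.impossible
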